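{- For all $k,n\in\mathbb{N}$, all regular threads $T$ and all meadows $\mathcal{M}$: (1) $R^{\mathcal{M}}_{T,n}\subseteq R^{\mathcal{M}}_{T,n+1}$; (2) $R^{\mathcal{M}}_{T,n}=R^{\mathcal{M}}_{\pi_{n+1}(T),n}$; (3) for all $x_0,\dots,x_k\in\mathcal{M}$, if $(x_0,\dots,x_k)\in[\![R_{T,k,n}]\!]_{\mathcal{M}}$ then $(x_0,\dots,x_k)\in[\![R_{T,k,n+1}]\!]_{\mathcal{M}}$; (4) for all $x_0,\dots,x_k\in\mathcal{M}$, $(x_0,\dots,x_k)\in[\![R_{T,k,n}]\!]_{\mathcal{M}}$ if and only if $(x_0,\dots,x_k)\in[\![R_{\pi_{n+1}(T),k,n}]\!]_{\mathcal{M}}$.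
   Context: A meadow is a commutative ring with unit with a total unary $x\mapsto x^{ -1}$ satisfying $(x^{ -1})^{ -1}=x$ and $x\cdot(x\cdot x^{ -1})=x$. Variables $\mathit{Var}$: input $x_0,x_1,\dots$, auxiliary $a_0,a_1,\dots$, output $y$. Actions: assignments $a_i.\mathtt{cp}(x_j)$, $a_i.\mathtt{set{:}0}$, $a_i.\mathtt{set{:}1}$, $a_i.\mathtt{set{:}ai}$, $a_i.\mathtt{set{:}mi}$, $a_i.\mathtt{set{:}a}(a_j)$, $a_i.\mathtt{set{:}m}(a_j)$, $y.\mathtt{cp}(a_j)$, and tests $a_i.\mathtt{test{:}0}$. Threads are (possibly infinite) binary trees: $\mathsf{S}$, $\mathsf{D}$, or $T_1\trianglelefteq\mathtt{a}\trianglerighteq T_2$ for an action $\mathtt{a}$; $\mathtt{a}\circ T$ abbreviates $T\trianglelefteq\mathtt{a}\trianglerighteq T$; assignments occur only as $\mathtt{a}\circ T$. A thread is regular if it has finitely many distinct subthreads (equivalently, it is the behaviour of a PGA instruction sequence). Approximation: $\pi_0(T)=\mathsf{D}$, $\pi_{n+1}(\mathsf{S})=\mathsf{S}$, $\pi_{n+1}(\mathsf{D})=\mathsf{D}$, $\pi_{n+1}(T_1\trianglelefteq\mathtt{a}\trianglerighteq T_2)=\pi_n(T_1)\trianglelefteq\mathtt{a}\trianglerighteq\pi_n(T_2)$. For $\alpha\in\mathcal{M}^{\mathit{Var}}$, $\alpha[v:=m]$ is $\alpha$ with $v$ reassigned to $m$. $R^{\mathcal{M}}_{T,n}\subseteq\mathcal{M}^{\mathit{Var}}$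 is defined by: $R^{\mathcal{M}}_{T,0}=\mathcal{M}^{\mathit{Var}}$ if $T=\mathsf{S}$ and $\emptyset$ otherwise; $R^{\mathcal{M}}_{\mathsf{S},n+1}=\mathcal{M}^{\mathit{Var}}$; $R^{\mathcal{M}}_{\mathsf{D},n+1}=\emptyset$; for an assignment $\mathtt{a}$ with effect $\alpha\mapsto\alpha'$ (namely $a_i.\mathtt{cp}(x_j)$: $\alpha[a_i:=\alpha(x_j)]$; $a_i.\mathtt{set{:}0}$: $\alpha[a_i:=0]$; $a_i.\mathtt{set{:}1}$: $\alpha[a_i:=1]$; $a_i.\mathtt{set{:}ai}$: $\alpha[a_i:=-\alpha(a_i)]$; $a_i.\mathtt{set{:}mi}$: $\alpha[a_i:=\alpha(a_i)^{ -1}]$; $a_i.\mathtt{set{:}a}(a_j)$: $\alpha[a_i:=\alpha(a_i)+\alpha(a_j)]$; $a_i.\mathtt{set{:}m}(a_j)$: $\alpha[a_i:=\alpha(a_i)\cdot\alpha(a_j)]$; $y.\mathtt{cp}(a_j)$: $\alpha[y:=\alpha(a_j)]$), $R^{\mathcal{M}}_{\mathtt{a}\circ T,n+1}=\{\alpha\mid\alpha'\in R^{\mathcal{M}}_{T,n}\}$; and $R^{\mathcal{M}}_{T_1\trianglelefteq a_i.\mathtt{test{:}0}\trianglerighteq T_2,n+1}=\{\alpha\in R^{\mathcal{M}}_{T_1,n}\mid\alpha(a_i)=0\}\cup\{\alpha\in R^{\mathcal{M}}_{T_2,n}\mid\alpha(a_i)\neq0\}$. Finally $[\![R_{T,k,n}]\!]_{\mathcal{M}}=\{(\alpha(x_0),\dots,\alpha(x_k))\mid\alpha\in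 R^{\mathcal{M}}_{T,n}\}\subseteq\mathcal{M}^{k+1}$. -}

module Defs where

open import Level using (Level; _⊔_) renaming (suc to lsuc)
open import Data.Nat using (ℕ; zero; suc)
import Data.Nat as ℕ
open import Data.Fin using (Fin; toℕ)
open import Data.Vec using (Vec; lookup)
open import Data.List using (List; []; _∷_; _++_)
open import Data.List.Relation.Unary.Any using (Any)
open import Data.Product using (Σ; _×_; _,_)
open import Data.Sum using (_⊎_)
open import Data.Unit.Polymorphic using (⊤)
open import Data.Empty.Polymorphic using (⊥)
open import Relation.Nullary using (¬_; Dec; yes; no)
open import Relation.Binary.PropositionalEquality using (_≡_)
open import Algebra.Bundles using (CommutativeRing)

record Meadow (c ℓ : Level) : Set (lsuc (c ⊔ ℓ)) where
  field
    commutativeRing : CommutativeRing c ℓ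
  open CommutativeRing commutativeRing public
  infix 8 _⁻¹
  field
    _⁻¹       : Carrier → Carrier
    ⁻¹-cong   : ∀ {x y} → x ≈ y → x ⁻¹ ≈ y ⁻¹
    ⁻¹-invol  : ∀ x → (x ⁻¹) ⁻¹ ≈ x
    ril       : ∀ x → x * (x * x ⁻¹) ≈ x

-- Variables: inputs x_j, auxiliaries a_i, output y

data Var : Set where
  x : ℕ → Var
  a : ℕ → Var
  y : Var

data Assign : Set where
  a-cp    : ℕ → ℕ → Assign
  a-set0  : ℕ → Assign
  a-set1  : ℕ → Assign
  a-setai : ℕ → Assign
  a-setmi : ℕ → Assign
  a-seta  : ℕ → ℕ → Assign
  a-setm  : ℕ → ℕ → Assign
  y-cp    : ℕ → Assign

-- Threads: possibly infinite binary trees over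
--   S, D, a ∘ T (= T ⊴ a ⊵ T, a an assignment), T₁ ⊴ a_i.test:0 ⊵ T₂.
-- A path is a list of directions: ↓ goes to the unique continuation of
-- an assignment node, ◁ / ▷ to the left / right branch of a test node.
-- Labels at paths that do not exist in the tree are irrelevant; thread
-- equality is bisimilarity, i.e. equality of all finite approximations.

data Label : Set where
  S    : Label
  D    : Label
  act  : Assign → Label
  test : ℕ → Label

data Dir : Set where
  ↓ ◁ ▷ : Dir

Thread : Set
Thread = List Dir → Label

_/_ : Thread → Dir → Thread
(T / d) p = T (d ∷ p)

data FinThread : Set where
  S    : FinThread
  D    : FinThread
  _∘_  : Assign → FinThread → FinThread
  test : ℕ → FinThread → FinThread → FinThread

mutual
  approx : ℕ → Thread → FinThread
  approx zero T = D
  approx (suc n) T = approxL n (T []) T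

  approxL : ℕ → Label → Thread → FinThread
  approxL n S T = S
  approxL n D T = D
  approxL n (act c) T = c ∘ approx n (T / ↓)
  approxL n (test i) T = test i (approx n (T / ◁)) (approx n (T / ▷))

_≈T_ : Thread → Thread → Set
T ≈T U = ∀ n → approx n T ≡ approx n U

data Path (T : Thread) : List Dir → Set where
  []  : Path T []
  ↓∷  : ∀ {c p} → T [] ≡ act c → Path (T / ↓) p → Path T (↓ ∷ p)
  ◁∷  : ∀ {i p} → T [] ≡ test i → Path (T / ◁) p → Path T (◁ ∷ p)
  ▷∷  : ∀ {i p} → T [] ≡ test i → Path (T / ▷) p → Path T (▷ ∷ p)

sub : Thread → List Dir → Thread
sub T p q = T (p ++ q)

Regular : Thread → Set
Regular T = Σ (List Thread) λ L → ∀ p → Path T p → Any (sub T p ≈T_) L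

π : ℕ → Thread → Thread
π zero T p = D
π (suc n) T [] = T []
π (suc n) T (d ∷ p) = π n (T / d) p

module Semantics {c ℓ} (M : Meadow c ℓ) where
  open Meadow M

  Valuation : Set c
  Valuation = Var → Carrier

  _≟V_ : (v w : Var) → Dec (v ≡ w)
  x i ≟V x j with i ℕ.≟ j
  ... | yes _≡_.refl = yes _≡_.refl
  ... | no ne = no λ { _≡_.refl → ne _≡_.refl }
  x _ ≟V a _ = no λ ()
  x _ ≟V y = no λ ()
  a _ ≟V x _ = no λ ()
  a i ≟V a j with i ℕ.≟ j
  ... | yes _≡_.refl = yes _≡_.refl
  ... | no ne = no λ { _≡_.refl → ne _≡_.refl }
  a _ ≟V y = no λ ()
  y ≟V x _ = no λ ()
  y ≟V a _ = no λ ()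
  y ≟V y = yes _≡_.refl

  _[_≔_] : Valuation → Var → Carrier → Valuation
  (α [ v ≔ m ]) w with w ≟V v
  ... | yes _ = m
  ... | no _  = α w

  effect : Assign → Valuation → Valuation
  effect (a-cp i j)  α = α [ a i ≔ α (x j) ]
  effect (a-set0 i)  α = α [ a i ≔ 0# ]
  effect (a-set1 i)  α = α [ a i ≔ 1# ]
  effect (a-setai i) α = α [ a i ≔ - α (a i) ]
  effect (a-setmi i) α = α [ a i ≔ α (a i) ⁻¹ ]
  effect (a-seta i j) α = α [ a i ≔ α (a i) + α (a j) ]
  effect (a-setm i j) α = α [ a i ≔ α (a i) * α (a j) ]
  effect (y-cp j)    α = α [ y ≔ α (a j) ]

  mutual
    R : Thread → ℕ → Valuation → Set ℓ
    R T zero α    = R₀ (T [])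
    R T (suc n) α = Rnode (T []) T n α

    R₀ : Label → Set ℓ
    R₀ S = ⊤
    R₀ _ = ⊥

    Rnode : Label → Thread → ℕ → Valuation → Set ℓ
    Rnode S T n α = ⊤
    Rnode D T n α = ⊥
    Rnode (act c) T n α = R (T / ↓) n (effect c α)
    Rnode (test i) T n α =
      (α (a i) ≈ 0# × R (T / ◁) n α) ⊎ (¬ (α (a i) ≈ 0#) × R (T / ▷) n α)

  ⟦R⟧ : Thread → (k : ℕ) → ℕ → Vec Carrier (suc k) → Set (c ⊔ ℓ)
  ⟦R⟧ T k n v = Σ Valuation λ α → R T n α × (∀ (j : Fin (suc k)) → α (x (toℕ j)) ≈ lookup v j)

open Semantics public

-- R_{T,n} reads only the labels of T at depth at most n, and π_{n+1}(T)
-- has the same labels there; monotonicity in n holds because a run that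
-- reaches S within n steps still reaches it within n+1.
module Submission where

open import Defs
open import Data.Nat using (ℕ; zero; suc; _≤_; z≤n; s≤s)
open import Data.Nat.Properties using (≤-pred)
open import Data.List using ([]; _∷_; length)
open import Data.Vec using (Vec)
open import Data.Product using (_×_; _,_)
open import Data.Sum using (inj₁; inj₂)
open import Function.Bundles using (_⇔_; mk⇔; Equivalence)
open import Relation.Binary.PropositionalEquality using (_≡_; refl; sym; subst)

_≗[_]_ : Thread → ℕ → Thread → Set
T ≗[ n ] U = ∀ p → length p ≤ n → T p ≡ U p

≗-sym : ∀ {T U n} → T ≗[ n ] U → U ≗[ n ] T
≗-sym T≗U p p≤n = sym (T≗U p p≤n)

≗-/ : ∀ {T U n} → T ≗[ suc n ] U → ∀ d → (T / d) ≗[ n ] (U / d)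
≗-/ T≗U d p p≤n = T≗U (d ∷ p) (s≤s p≤n)

≗-π : ∀ n T → T ≗[ n ] π (suc n) T
≗-π n       T []      _       = refl
≗-π (suc n) T (d ∷ p) 1+p≤1+n = ≗-π n (T / d) p (≤-pred 1+p≤1+n)

module _ {c ℓ} (M : Meadow c ℓ) where

  mutual
    R-mono : ∀ n T α → R M T n α → R M T (suc n) α
    R-mono zero    T α r = R₀⇒Rnode (T []) T α r
    R-mono (suc n) T α r = Rnode-mono (T []) T n α r

    R₀⇒Rnode : ∀ l T α → R₀ M l → Rnode M l T 0 α
    R₀⇒Rnode S T α r = r

    Rnode-mono : ∀ l T n α → Rnode M l T n α → Rnode M l T (suc n) α
    Rnode-mono S        T n α r                = r
    Rnode-mono (act c)  T n α r                = R-mono n (T / ↓) (effect M c α) r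
    Rnode-mono (test i) T n α (inj₁ (z , r))   = inj₁ (z , R-mono n (T / ◁) α r)
    Rnode-mono (test i) T n α (inj₂ (nz , r))  = inj₂ (nz , R-mono n (T / ▷) α r)

  mutual
    R-≗ : ∀ n {T U} α → T ≗[ n ] U → R M T n α → R M U n α
    R-≗ zero    α T≗U r = subst (R₀ M) (T≗U [] z≤n) r
    R-≗ (suc n) {T} {U} α T≗U r =
      subst (λ l → Rnode M l U n α) (T≗U [] z≤n)
            (Rnode-≗ (T []) n α (≗-/ T≗U) r)

    Rnode-≗ : ∀ l n {T U} α → (∀ d → (T / d) ≗[ n ] (U / d)) →
              Rnode M l T n α → Rnode M l U n α
    Rnode-≗ S        n α T≗U r               = r
    Rnode-≗ (act c)  n α T≗U r               = R-≗ n (effect M c α) (T≗U ↓) r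
    Rnode-≗ (test i) n α T≗U (inj₁ (z , r))  = inj₁ (z , R-≗ n α (T≗U ◁) r)
    Rnode-≗ (test i) n α T≗U (inj₂ (nz , r)) = inj₂ (nz , R-≗ n α (T≗U ▷) r)

  R-π : ∀ n T α → R M T n α ⇔ R M (π (suc n) T) n α
  R-π n T α = mk⇔ (R-≗ n α (≗-π n T)) (R-≗ n α (≗-sym (≗-π n T)))

  ⟦R⟧-map : ∀ {k} T n U m → (∀ α → R M T n α → R M U m α) →
            ∀ v → ⟦R⟧ M T k n v → ⟦R⟧ M U k m v
  ⟦R⟧-map T n U m T⊆U v (α , r , α≈v) = α , T⊆U α r , α≈v

  ⟦R⟧-⇔ : ∀ {k} T n U m → (∀ α → R M T n α ⇔ R M U m α) →
          ∀ v → ⟦R⟧ M T k n v ⇔ ⟦R⟧ M U k m v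
  ⟦R⟧-⇔ T n U m T⇔U v = mk⇔ (⟦R⟧-map T n U m (λ α → Equivalence.to (T⇔U α)) v)
                            (⟦R⟧-map U m T n (λ α → Equivalence.from (T⇔U α)) v)

mainTheorem9 : ∀ {c ℓ} (M : Meadow c ℓ) (k n : ℕ) (T : Thread) → Regular T →
    (∀ α → R M T n α → R M T (suc n) α)
    × (∀ α → R M T n α ⇔ R M (π (suc n) T) n α)
    × (∀ (v : Vec (Meadow.Carrier M) (suc k)) → ⟦R⟧ M T k n v → ⟦R⟧ M T k (suc n) v)
    × (∀ (v : Vec (Meadow.Carrier M) (suc k)) → ⟦R⟧ M T k n v ⇔ ⟦R⟧ M (π (suc n) T) k n v)
mainTheorem9 M k n T _ =
    R-mono M n T
  , R-π M n T
  , ⟦R⟧-map M T n T (suc n) (R-mono M n T)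
  , ⟦R⟧-⇔ M T n (π (suc n) T) n (R-π M n T)
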